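{- Let $n\ge 0$, let $G(x,y)$ be a homogeneous polynomial of degree $2n$ in two variables with complex coefficients, and let $P(x)$ be a monic polynomial of degree $n+1$ with distinct roots. Then $$\sum_{\alpha,\beta\in\mathbb{C},\ P(\alpha)=P(\beta)=0}\frac{G(\alpha,\beta)}{P'(\alpha)P'(\beta)}$$ (the sum over all ordered pairs of roots, including $\alpha=\beta$) is independent of $P$ and equals the coefficient of $x^ny^n$ in $G(x,y)$. -}

module Defs where

open import Level using (_⊔_)
open import Algebra.Bundles using (CommutativeRing)
open import Data.Nat as ℕ using (ℕ; zero; suc)
open import Data.Nat.Properties using (m≤m+n)
open import Data.Fin as Fin using (Fin; toℕ; fromℕ; fromℕ<)
open import Data.Product using (∃)
open import Relation.Nullary using (¬_)
open import Relation.Binary.PropositionalEquality using (_≡_)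

-- A field: a commutative ring with 1 ≠ 0 and a (total) inverse map that is a
-- two-sided inverse on nonzero elements (the value of 0⁻¹ is irrelevant).
record Field (c ℓ : Level.Level) : Set (Level.suc (c ⊔ ℓ)) where
  field
    commRing : CommutativeRing c ℓ
  open CommutativeRing commRing public
  field
    _⁻¹      : Carrier → Carrier
    ⁻¹-inverse : ∀ x → ¬ (x ≈ 0#) → x * (x ⁻¹) ≈ 1#
    1≉0      : ¬ (1# ≈ 0#)

module FieldOps {c ℓ} (K : Field c ℓ) where
  open Field K

  pow : Carrier → ℕ → Carrier
  pow x zero    = 1#
  pow x (suc k) = x * pow x k

  natCast : ℕ → Carrier
  natCast zero    = 0#
  natCast (suc m) = 1# + natCast m

  sumFin : (m : ℕ) → (Fin m → Carrier) → Carrier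
  sumFin zero    f = 0#
  sumFin (suc m) f = f Fin.zero + sumFin m (λ i → f (Fin.suc i))

  -- Univariate polynomial of degree ≤ d, given by its coefficients p i (of x^i).
  Poly : ℕ → Set c
  Poly d = Fin (suc d) → Carrier

  eval : ∀ {d} → Poly d → Carrier → Carrier
  eval {d} p x = sumFin (suc d) (λ i → p i * pow x (toℕ i))

  deriv : ∀ {d} → Poly (suc d) → Poly d
  deriv p i = natCast (suc (toℕ i)) * p (Fin.suc i)

  Monic : ∀ {d} → Poly d → Set ℓ
  Monic {d} p = p (fromℕ d) ≈ 1#

  -- Homogeneous polynomial of degree e in two variables:
  -- G(x,y) = Σ_{k ≤ e} g k · x^k · y^(e-k)
  HomPoly₂ : ℕ → Set c
  HomPoly₂ e = Fin (suc e) → Carrier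

  evalHom : ∀ {e} → HomPoly₂ e → Carrier → Carrier → Carrier
  evalHom {e} g x y =
    sumFin (suc e) (λ k → g k * (pow x (toℕ k) * pow y (e ℕ.∸ toℕ k)))

  -- index k = n in a homogeneous polynomial of degree 2n (= n + n),
  -- i.e. the monomial x^n y^n
  middle : (n : ℕ) → Fin (suc (n ℕ.+ n))
  middle n = fromℕ< {n} (ℕ.s≤s (m≤m+n n n))

  AlgClosed : Set (c ⊔ ℓ)
  AlgClosed = ∀ (d : ℕ) (p : Poly (suc d)) → Monic p → ∃ λ α → eval p α ≈ 0#

  CharZero : Set ℓ
  CharZero = ∀ (m : ℕ) → ¬ (natCast (suc m) ≈ 0#)

{-# OPTIONS --safe #-}
module Submission where

-- Put w i = 1 / P′(r i) and S m = Σᵢ (r i)ᵐ w i. Expanding G turns the double sum into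
-- Σₖ g k · S k · S (2n − k). The quotients Qᵢ = P / (x − r i) are monic of degree n, vanish at
-- r j for j ≠ i and satisfy Qᵢ(r i) = P′(r i) ≠ 0, so Lagrange interpolation at the n + 1 roots
-- shows that the coefficient of xⁿ of every polynomial p of degree ≤ n is Σᵢ p(r i) w i.
-- For p = xᵐ this gives S m = 0 when m < n and S n = 1, so only the term k = n survives.

open import Defs
import Data.Nat as ℕ
open ℕ using (ℕ; zero; suc; _<_)
open import Data.Nat.Properties
  using (<-cmp; <⇒≢; m+n∸n≡m; ∸-monoʳ-<; m<1+n⇒m≤n; m<n⇒m<1+n; n<1+n)
open import Data.Fin as Fin using (Fin; zero; suc; toℕ; fromℕ; fromℕ<)
open import Data.Fin.Properties
  using (suc-injective; toℕ-injective; toℕ-fromℕ; toℕ-fromℕ<; toℕ<n; 0≢1+n)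
open import Data.Vec.Functional using (tail)
open import Data.Product using (∃)
open import Data.Empty using (⊥-elim)
open import Function using (_∘_)
open import Function.Definitions using (Injective)
open import Relation.Binary.Definitions using (tri<; tri≈; tri>)
open import Relation.Binary.PropositionalEquality as ≡ using (_≡_; _≢_)
open import Relation.Nullary using (¬_; yes; no)

module FieldPolynomials {c ℓ} (K : Field c ℓ) where
  open Field K hiding (zero)
  open FieldOps K
  open import Relation.Binary.Reasoning.Setoid setoid
  open import Algebra.Solver.Ring.NaturalCoefficients.Default commutativeSemiring
    using (solve; _:+_; _:*_; _:=_)
  open import Algebra.Properties.Group +-group using (x∙y⁻¹≈ε⇒x≈y; //-rightDividesˡ)
    renaming (∙-cancelʳ to +-cancelʳ)
  open import Algebra.Properties.CommutativeSemigroup +-commutativeSemigroup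
    using () renaming (interchange to +-interchange)
  open import Algebra.Properties.CommutativeSemigroup *-commutativeSemigroup
    using () renaming (interchange to *-interchange; x∙yz≈y∙xz to x*yz≈y*xz)

  sumFin-cong : ∀ m {f g : Fin m → Carrier} → (∀ i → f i ≈ g i) → sumFin m f ≈ sumFin m g
  sumFin-cong zero    f≈g = refl
  sumFin-cong (suc m) f≈g = +-cong (f≈g zero) (sumFin-cong m (f≈g ∘ suc))

  sumFin-zero : ∀ m {f : Fin m → Carrier} → (∀ i → f i ≈ 0#) → sumFin m f ≈ 0#
  sumFin-zero zero    f≈0 = refl
  sumFin-zero (suc m) f≈0 = trans (+-cong (f≈0 zero) (sumFin-zero m (f≈0 ∘ suc))) (+-identityˡ 0#)

  sumFin-distrib-+ : ∀ m (f g : Fin m → Carrier) →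
                     sumFin m (λ i → f i + g i) ≈ sumFin m f + sumFin m g
  sumFin-distrib-+ zero    f g = sym (+-identityˡ 0#)
  sumFin-distrib-+ (suc m) f g =
    trans (+-congˡ (sumFin-distrib-+ m (f ∘ suc) (g ∘ suc))) (+-interchange _ _ _ _)

  *-distribˡ-sumFin : ∀ m x (f : Fin m → Carrier) → x * sumFin m f ≈ sumFin m (λ i → x * f i)
  *-distribˡ-sumFin zero    x f = zeroʳ x
  *-distribˡ-sumFin (suc m) x f = trans (distribˡ x _ _) (+-congˡ (*-distribˡ-sumFin m x (f ∘ suc)))

  *-distribʳ-sumFin : ∀ m x (f : Fin m → Carrier) → sumFin m f * x ≈ sumFin m (λ i → f i * x)
  *-distribʳ-sumFin zero    x f = zeroˡ x
  *-distribʳ-sumFin (suc m) x f = trans (distribʳ x _ _) (+-congˡ (*-distribʳ-sumFin m x (f ∘ suc)))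

  sumFin-comm : ∀ m k (f : Fin m → Fin k → Carrier) →
                sumFin m (λ i → sumFin k (f i)) ≈ sumFin k (λ j → sumFin m (λ i → f i j))
  sumFin-comm zero    k f = sym (sumFin-zero k (λ _ → refl))
  sumFin-comm (suc m) k f =
    trans (+-congˡ (sumFin-comm m k (f ∘ suc))) (sym (sumFin-distrib-+ k (f zero) _))

  sumFin-*-sumFin : ∀ m k (f : Fin m → Carrier) (g : Fin k → Carrier) →
                    sumFin m f * sumFin k g ≈ sumFin m (λ i → sumFin k (λ j → f i * g j))
  sumFin-*-sumFin m k f g =
    trans (*-distribʳ-sumFin m _ f) (sumFin-cong m (λ i → *-distribˡ-sumFin k (f i) g))

  sumFin-single : ∀ m (f : Fin m → Carrier) k → (∀ i → i ≢ k → f i ≈ 0#) → sumFin m f ≈ f k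
  sumFin-single (suc m) f zero    f≈0 =
    trans (+-congˡ (sumFin-zero m (λ i → f≈0 (suc i) (0≢1+n ∘ ≡.sym)))) (+-identityʳ _)
  sumFin-single (suc m) f (suc k) f≈0 =
    trans (+-cong (f≈0 zero 0≢1+n)
                  (sumFin-single m (f ∘ suc) k (λ i i≢k → f≈0 (suc i) (i≢k ∘ suc-injective))))
          (+-identityˡ _)

  *-cancelˡ-≉0 : ∀ {d u v} → ¬ d ≈ 0# → d * u ≈ d * v → u ≈ v
  *-cancelˡ-≉0 {d} {u} {v} d≉0 du≈dv = begin
    u                ≈⟨ unscale u ⟨
    d ⁻¹ * (d * u)   ≈⟨ *-congˡ du≈dv ⟩
    d ⁻¹ * (d * v)   ≈⟨ unscale v ⟩
    v                ∎
    where
    unscale : ∀ x → d ⁻¹ * (d * x) ≈ x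
    unscale x = begin
      d ⁻¹ * (d * x)   ≈⟨ x*yz≈y*xz (d ⁻¹) d x ⟩
      d * (d ⁻¹ * x)   ≈⟨ *-assoc d (d ⁻¹) x ⟨
      (d * d ⁻¹) * x   ≈⟨ *-congʳ (⁻¹-inverse d d≉0) ⟩
      1# * x           ≈⟨ *-identityˡ x ⟩
      x                ∎

  *-≉0 : ∀ {x y} → ¬ x ≈ 0# → ¬ y ≈ 0# → ¬ x * y ≈ 0#
  *-≉0 {x} x≉0 y≉0 xy≈0 = y≉0 (*-cancelˡ-≉0 x≉0 (trans xy≈0 (sym (zeroʳ x))))

  x≉a⇒x-a≉0 : ∀ {x a} → ¬ x ≈ a → ¬ x - a ≈ 0#
  x≉a⇒x-a≉0 {x} {a} x≉a = x≉a ∘ x∙y⁻¹≈ε⇒x≈y x a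

  ⁻¹-distrib-* : ∀ {x y} → ¬ x ≈ 0# → ¬ y ≈ 0# → (x * y) ⁻¹ ≈ x ⁻¹ * y ⁻¹
  ⁻¹-distrib-* {x} {y} x≉0 y≉0 = *-cancelˡ-≉0 (*-≉0 x≉0 y≉0) (begin
    (x * y) * (x * y) ⁻¹      ≈⟨ ⁻¹-inverse (x * y) (*-≉0 x≉0 y≉0) ⟩
    1#                        ≈⟨ *-identityˡ 1# ⟨
    1# * 1#                   ≈⟨ *-cong (⁻¹-inverse x x≉0) (⁻¹-inverse y y≉0) ⟨
    (x * x ⁻¹) * (y * y ⁻¹)   ≈⟨ *-interchange x (x ⁻¹) y (y ⁻¹) ⟩
    (x * y) * (x ⁻¹ * y ⁻¹)   ∎)

  terms : ∀ {d} → Poly d → Carrier → Fin (suc d) → Carrier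
  terms p x i = p i * pow x (toℕ i)

  eval₀ : (p : Poly 0) (x : Carrier) → eval p x ≈ p zero
  eval₀ p x = trans (+-identityʳ _) (*-identityʳ _)

  eval-tail : ∀ {d} (p : Poly (suc d)) x → eval p x ≈ p zero + x * eval (tail p) x
  eval-tail {d} p x = +-cong (*-identityʳ (p zero)) (begin
    sumFin (suc d) (λ i → p (suc i) * (x * pow x (toℕ i)))
      ≈⟨ sumFin-cong (suc d) (λ i → x*yz≈y*xz (p (suc i)) x (pow x (toℕ i))) ⟩
    sumFin (suc d) (λ i → x * (p (suc i) * pow x (toℕ i)))
      ≈⟨ *-distribˡ-sumFin (suc d) x (terms (tail p) x) ⟨
    x * eval (tail p) x
      ∎)

  eval-cong : ∀ {d} {p q : Poly d} → (∀ i → p i ≈ q i) → ∀ x → eval p x ≈ eval q x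
  eval-cong {d} p≈q x = sumFin-cong (suc d) (λ i → *-congʳ {pow x (toℕ i)} (p≈q i))

  eval-0# : ∀ {d} x → eval {d} (λ _ → 0#) x ≈ 0#
  eval-0# {d} x = sumFin-zero (suc d) (λ i → zeroˡ (pow x (toℕ i)))

  eval-+ : ∀ {d} (p q : Poly d) x → eval (λ i → p i + q i) x ≈ eval p x + eval q x
  eval-+ {d} p q x = trans (sumFin-cong (suc d) (λ i → distribʳ (pow x (toℕ i)) (p i) (q i)))
                           (sumFin-distrib-+ (suc d) (terms p x) (terms q x))

  eval-∑ : ∀ {d} m (c : Fin m → Carrier) (R : Fin m → Poly d) x →
           eval (λ l → sumFin m (λ i → c i * R i l)) x ≈ sumFin m (λ i → c i * eval (R i) x)
  eval-∑ {d} m c R x = begin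
    sumFin (suc d) (λ l → sumFin m (λ i → c i * R i l) * pow x (toℕ l))
      ≈⟨ sumFin-cong (suc d) (λ l → *-distribʳ-sumFin m (pow x (toℕ l)) (λ i → c i * R i l)) ⟩
    sumFin (suc d) (λ l → sumFin m (λ i → (c i * R i l) * pow x (toℕ l)))
      ≈⟨ sumFin-comm (suc d) m (λ l i → (c i * R i l) * pow x (toℕ l)) ⟩
    sumFin m (λ i → sumFin (suc d) (λ l → (c i * R i l) * pow x (toℕ l)))
      ≈⟨ sumFin-cong m (λ i → sumFin-cong (suc d) (λ l → *-assoc (c i) (R i l) (pow x (toℕ l)))) ⟩
    sumFin m (λ i → sumFin (suc d) (λ l → c i * (R i l * pow x (toℕ l))))
      ≈⟨ sumFin-cong m (λ i → *-distribˡ-sumFin (suc d) (c i) (terms (R i) x)) ⟨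
    sumFin m (λ i → c i * eval (R i) x)
      ∎

  quot : ∀ {d} → Poly (suc d) → Carrier → Poly d
  quot p a zero            = eval (tail p) a
  quot {suc d} p a (suc i) = quot (tail p) a i

  quot-top : ∀ {d} (p : Poly (suc d)) a → quot p a (fromℕ d) ≈ p (fromℕ (suc d))
  quot-top {zero}  p a = eval₀ (tail p) a
  quot-top {suc d} p a = quot-top (tail p) a

  -- The common step of both cases of eval-quot, t being the value at x of the quotient of tail p
  -- (0 when tail p is constant). Writing x as δ + a with δ = x − a makes it a semiring identity.
  eval-quot-step : ∀ {d} (p : Poly (suc d)) a x t →
                   eval (tail p) x ≈ (x - a) * t + eval (tail p) a →
                   eval (quot p a) x ≈ eval (tail p) a + x * t →
                   eval p x ≈ (x - a) * eval (quot p a) x + eval p a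
  eval-quot-step p a x t tail-x quot-x = begin
    eval p x
      ≈⟨ eval-tail p x ⟩
    p zero + x * eval (tail p) x
      ≈⟨ +-congˡ (*-cong x≈δ+a tail-x) ⟩
    p zero + (δ + a) * (δ * t + tₐ)
      ≈⟨ expand (p zero) δ a t tₐ ⟩
    δ * (tₐ + (δ + a) * t) + (p zero + a * tₐ)
      ≈⟨ +-cong (*-congˡ (+-congˡ (*-congʳ (sym x≈δ+a)))) (sym (eval-tail p a)) ⟩
    δ * (tₐ + x * t) + eval p a
      ≈⟨ +-congʳ (*-congˡ quot-x) ⟨
    δ * eval (quot p a) x + eval p a
      ∎
    where
    δ  = x - a
    tₐ = eval (tail p) a
    x≈δ+a : x ≈ δ + a
    x≈δ+a = sym (//-rightDividesˡ a x)
    expand : ∀ p₀ δ a t tₐ →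
             p₀ + (δ + a) * (δ * t + tₐ) ≈ δ * (tₐ + (δ + a) * t) + (p₀ + a * tₐ)
    expand = solve 5 (λ p₀ δ a t tₐ → p₀ :+ (δ :+ a) :* (δ :* t :+ tₐ)
                                   := δ :* (tₐ :+ (δ :+ a) :* t) :+ (p₀ :+ a :* tₐ)) refl

  eval-quot : ∀ {d} (p : Poly (suc d)) a x → eval p x ≈ (x - a) * eval (quot p a) x + eval p a
  eval-quot {zero} p a x = eval-quot-step p a x 0#
    (trans (eval₀ (tail p) x) (sym (trans (+-cong (zeroʳ (x - a)) (eval₀ (tail p) a)) (+-identityˡ _))))
    (trans (eval₀ (quot p a) x) (sym (trans (+-congˡ (zeroʳ x)) (+-identityʳ _))))
  eval-quot {suc d} p a x = eval-quot-step p a x (eval (quot (tail p) a) x)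
    (eval-quot (tail p) a x) (eval-tail (quot p a) x)

  eval-deriv-tail : ∀ {d} (p : Poly (suc (suc d))) x →
                    eval (deriv p) x ≈ eval (tail p) x + x * eval (deriv (tail p)) x
  eval-deriv-tail p x = begin
    eval (deriv p) x
      ≈⟨ eval-tail (deriv p) x ⟩
    natCast 1 * p₁ + x * eval (tail (deriv p)) x
      ≈⟨ +-cong (trans (*-congʳ (+-identityʳ 1#)) (*-identityˡ p₁))
                (*-congˡ (trans (eval-cong split x) (eval-+ (tail (tail p)) (deriv (tail p)) x))) ⟩
    p₁ + x * (eval (tail (tail p)) x + eval (deriv (tail p)) x)
      ≈⟨ regroup p₁ x _ _ ⟩
    (p₁ + x * eval (tail (tail p)) x) + x * eval (deriv (tail p)) x
      ≈⟨ +-congʳ (eval-tail (tail p) x) ⟨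
    eval (tail p) x + x * eval (deriv (tail p)) x
      ∎
    where
    p₁ = p (suc zero)
    split : ∀ i → tail (deriv p) i ≈ tail (tail p) i + deriv (tail p) i
    split i = trans (distribʳ _ 1# _) (+-congʳ (*-identityˡ _))
    regroup : ∀ a x u v → a + x * (u + v) ≈ (a + x * u) + x * v
    regroup = solve 4 (λ a x u v → a :+ x :* (u :+ v) := (a :+ x :* u) :+ x :* v) refl

  eval-deriv≈eval-quot : ∀ {d} (p : Poly (suc d)) a → eval (deriv p) a ≈ eval (quot p a) a
  eval-deriv≈eval-quot {zero} p a = begin
    eval (deriv p) a          ≈⟨ eval₀ (deriv p) a ⟩
    natCast 1 * p (suc zero)  ≈⟨ trans (*-congʳ (+-identityʳ 1#)) (*-identityˡ _) ⟩
    p (suc zero)              ≈⟨ trans (eval₀ (quot p a) a) (eval₀ (tail p) a) ⟨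
    eval (quot p a) a         ∎
  eval-deriv≈eval-quot {suc d} p a = begin
    eval (deriv p) a
      ≈⟨ eval-deriv-tail p a ⟩
    eval (tail p) a + a * eval (deriv (tail p)) a
      ≈⟨ +-congˡ (*-congˡ (eval-deriv≈eval-quot (tail p) a)) ⟩
    eval (tail p) a + a * eval (quot (tail p) a) a
      ≈⟨ eval-tail (quot p a) a ⟨
    eval (quot p a) a
      ∎

  quot-agree : ∀ {d} (p q : Poly (suc d)) {a x} → ¬ x ≈ a →
               eval p a ≈ eval q a → eval p x ≈ eval q x → eval (quot p a) x ≈ eval (quot q a) x
  quot-agree p q {a} {x} x≉a pa≈qa px≈qx =
    *-cancelˡ-≉0 (x≉a⇒x-a≉0 x≉a) (+-cancelʳ (eval q a) _ _ (begin
    (x - a) * eval (quot p a) x + eval q a   ≈⟨ +-congˡ pa≈qa ⟨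
    (x - a) * eval (quot p a) x + eval p a   ≈⟨ eval-quot p a x ⟨
    eval p x                                 ≈⟨ px≈qx ⟩
    eval q x                                 ≈⟨ eval-quot q a x ⟩
    (x - a) * eval (quot q a) x + eval q a   ∎))

  quot-root : ∀ {d} (p : Poly (suc d)) {a x} → ¬ x ≈ a →
              eval p a ≈ 0# → eval p x ≈ 0# → eval (quot p a) x ≈ 0#
  quot-root p {a} {x} x≉a pa≈0 px≈0 = *-cancelˡ-≉0 (x≉a⇒x-a≉0 x≉a) (begin
    (x - a) * eval (quot p a) x              ≈⟨ +-identityʳ _ ⟨
    (x - a) * eval (quot p a) x + 0#         ≈⟨ +-congˡ pa≈0 ⟨
    (x - a) * eval (quot p a) x + eval p a   ≈⟨ eval-quot p a x ⟨
    eval p x                                 ≈⟨ px≈0 ⟩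
    0#                                       ≈⟨ zeroʳ (x - a) ⟨
    (x - a) * 0#                             ∎)

  top-coeff-unique : ∀ {d} (p q : Poly d) (r : Fin (suc d) → Carrier) → Injective _≡_ _≈_ r →
                     (∀ i → eval p (r i) ≈ eval q (r i)) → p (fromℕ d) ≈ q (fromℕ d)
  top-coeff-unique {zero} p q r _ p≈q =
    trans (sym (eval₀ p (r zero))) (trans (p≈q zero) (eval₀ q (r zero)))
  top-coeff-unique {suc d} p q r r-injective p≈q = begin
    p (fromℕ (suc d))    ≈⟨ quot-top p a ⟨
    quot p a (fromℕ d)   ≈⟨ top-coeff-unique (quot p a) (quot q a) (r ∘ suc)
                              (suc-injective ∘ r-injective) quotients-agree ⟩
    quot q a (fromℕ d)   ≈⟨ quot-top q a ⟩
    q (fromℕ (suc d))    ∎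
    where
    a = r zero
    quotients-agree : ∀ i → eval (quot p a) (r (suc i)) ≈ eval (quot q a) (r (suc i))
    quotients-agree i =
      quot-agree p q (0≢1+n ∘ ≡.sym ∘ r-injective) (p≈q zero) (p≈q (suc i))

  monomial : ∀ {d} → ℕ → Poly d
  monomial m l with toℕ l ℕ.≟ m
  ... | yes _ = 1#
  ... | no  _ = 0#

  monomial-≡ : ∀ {d m} (l : Fin (suc d)) → toℕ l ≡ m → monomial m l ≈ 1#
  monomial-≡ {m = m} l l≡m with toℕ l ℕ.≟ m
  ... | yes _   = refl
  ... | no  l≢m = ⊥-elim (l≢m l≡m)

  monomial-≢ : ∀ {d m} (l : Fin (suc d)) → toℕ l ≢ m → monomial m l ≈ 0#
  monomial-≢ {m = m} l l≢m with toℕ l ℕ.≟ m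
  ... | yes l≡m = ⊥-elim (l≢m l≡m)
  ... | no  _   = refl

  eval-monomial : ∀ {d m} → m < suc d → ∀ x → eval (monomial {d} m) x ≈ pow x m
  eval-monomial {d} {m} m<1+d x = begin
    eval (monomial m) x            ≈⟨ sumFin-single (suc d) (terms (monomial m) x) k off-k ⟩
    monomial m k * pow x (toℕ k)   ≈⟨ *-cong (monomial-≡ k k≡m) (reflexive (≡.cong (pow x) k≡m)) ⟩
    1# * pow x m                   ≈⟨ *-identityˡ (pow x m) ⟩
    pow x m                        ∎
    where
    k = fromℕ< m<1+d
    k≡m : toℕ k ≡ m
    k≡m = toℕ-fromℕ< m<1+d
    off-k : ∀ l → l ≢ k → monomial m l * pow x (toℕ l) ≈ 0#
    off-k l l≢k = trans (*-congʳ (monomial-≢ l l≢m)) (zeroˡ _)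
      where
      l≢m : toℕ l ≢ m
      l≢m l≡m = l≢k (toℕ-injective (≡.trans l≡m (≡.sym k≡m)))

  homTerms : ∀ {e} → HomPoly₂ e → Carrier → Carrier → Fin (suc e) → Carrier
  homTerms {e} G x y k = G k * (pow x (toℕ k) * pow y (e ℕ.∸ toℕ k))

  powerSum : ∀ {m} → (Fin m → Carrier) → (Fin m → Carrier) → ℕ → Carrier
  powerSum {m} w r k = sumFin m (λ i → pow (r i) k * w i)

  sumFin²-evalHom : ∀ {e m} (G : HomPoly₂ e) (r w : Fin m → Carrier) →
    sumFin m (λ i → sumFin m (λ j → evalHom G (r i) (r j) * (w i * w j)))
    ≈ sumFin (suc e) (λ k → G k * (powerSum w r (toℕ k) * powerSum w r (e ℕ.∸ toℕ k)))
  sumFin²-evalHom {e} {m} G r w = begin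
    sumFin m (λ i → sumFin m (λ j → evalHom G (r i) (r j) * (w i * w j)))
      ≈⟨ sumFin-cong m (λ i → sumFin-cong m (λ j → expand i j)) ⟩
    sumFin m (λ i → sumFin m (λ j → sumFin (suc e) (λ k → G k * (A k i * B k j))))
      ≈⟨ sumFin-cong m (λ i → sumFin-comm m (suc e) (λ j k → G k * (A k i * B k j))) ⟩
    sumFin m (λ i → sumFin (suc e) (λ k → sumFin m (λ j → G k * (A k i * B k j))))
      ≈⟨ sumFin-comm m (suc e) (λ i k → sumFin m (λ j → G k * (A k i * B k j))) ⟩
    sumFin (suc e) (λ k → sumFin m (λ i → sumFin m (λ j → G k * (A k i * B k j))))
      ≈⟨ sumFin-cong (suc e) (λ k → sym (factor k)) ⟩
    sumFin (suc e) (λ k → G k * (powerSum w r (toℕ k) * powerSum w r (e ℕ.∸ toℕ k)))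
      ∎
    where
    A B : Fin (suc e) → Fin m → Carrier
    A k i = pow (r i) (toℕ k) * w i
    B k j = pow (r j) (e ℕ.∸ toℕ k) * w j
    rearrange : ∀ g x y u v → (g * (x * y)) * (u * v) ≈ g * ((x * u) * (y * v))
    rearrange = solve 5 (λ g x y u v → (g :* (x :* y)) :* (u :* v) := g :* ((x :* u) :* (y :* v)))
                        refl
    expand : ∀ i j → evalHom G (r i) (r j) * (w i * w j) ≈ sumFin (suc e) (λ k → G k * (A k i * B k j))
    expand i j = trans (*-distribʳ-sumFin (suc e) (w i * w j) (homTerms G (r i) (r j)))
      (sumFin-cong (suc e) (λ k → rearrange (G k) (pow (r i) (toℕ k)) (pow (r j) (e ℕ.∸ toℕ k)) (w i) (w j)))
    factor : ∀ k → G k * (powerSum w r (toℕ k) * powerSum w r (e ℕ.∸ toℕ k))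
                   ≈ sumFin m (λ i → sumFin m (λ j → G k * (A k i * B k j)))
    factor k = begin
      G k * (sumFin m (A k) * sumFin m (B k))
        ≈⟨ *-congˡ (sumFin-*-sumFin m m (A k) (B k)) ⟩
      G k * sumFin m (λ i → sumFin m (λ j → A k i * B k j))
        ≈⟨ *-distribˡ-sumFin m (G k) _ ⟩
      sumFin m (λ i → G k * sumFin m (λ j → A k i * B k j))
        ≈⟨ sumFin-cong m (λ i → *-distribˡ-sumFin m (G k) _) ⟩
      sumFin m (λ i → sumFin m (λ j → G k * (A k i * B k j)))
        ∎

  middle-term : ∀ n (G : HomPoly₂ (n ℕ.+ n)) (S : ℕ → Carrier) →
                (∀ m → m < n → S m ≈ 0#) → S n ≈ 1# →
                sumFin (suc (n ℕ.+ n)) (λ k → G k * (S (toℕ k) * S (n ℕ.+ n ℕ.∸ toℕ k)))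
                ≈ G (middle n)
  middle-term n G S S<n≈0 Sn≈1 =
    trans (sumFin-single (suc (n ℕ.+ n)) _ (middle n) off-middle) at-middle
    where
    toℕ-middle : toℕ (middle n) ≡ n
    toℕ-middle = toℕ-fromℕ< _
    at-middle : G (middle n) * (S (toℕ (middle n)) * S (n ℕ.+ n ℕ.∸ toℕ (middle n)))
                ≈ G (middle n)
    at-middle rewrite toℕ-middle | m+n∸n≡m n n =
      trans (*-congˡ (trans (*-cong Sn≈1 Sn≈1) (*-identityˡ 1#))) (*-identityʳ _)
    off-middle : ∀ k → k ≢ middle n → G k * (S (toℕ k) * S (n ℕ.+ n ℕ.∸ toℕ k)) ≈ 0#
    off-middle k k≢middle with <-cmp (toℕ k) n
    ... | tri< k<n _ _ = trans (*-congˡ (trans (*-congʳ (S<n≈0 _ k<n)) (zeroˡ _))) (zeroʳ _)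
    ... | tri≈ _ k≡n _ = ⊥-elim (k≢middle (toℕ-injective (≡.trans k≡n (≡.sym toℕ-middle))))
    ... | tri> _ _ n<k = trans (*-congˡ (trans (*-congˡ (S<n≈0 _ 2n-k<n)) (zeroʳ _))) (zeroʳ _)
      where
      2n-k<n : n ℕ.+ n ℕ.∸ toℕ k < n
      2n-k<n = ≡.subst (n ℕ.+ n ℕ.∸ toℕ k <_) (m+n∸n≡m n n)
                       (∸-monoʳ-< n<k (m<1+n⇒m≤n (toℕ<n k)))

  module SimpleRoots (n : ℕ) (P : Poly (suc n)) (P-monic : Monic P)
                     (r : Fin (suc n) → Carrier) (r-injective : Injective _≡_ _≈_ r)
                     (r-roots : ∀ i → eval P (r i) ≈ 0#) where

    Q : Fin (suc n) → Poly n
    Q i = quot P (r i)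

    Q-monic : ∀ i → Monic (Q i)
    Q-monic i = trans (quot-top P (r i)) P-monic

    Q-root : ∀ {i j} → i ≢ j → eval (Q i) (r j) ≈ 0#
    Q-root i≢j = quot-root P (λ rj≈ri → i≢j (≡.sym (r-injective rj≈ri))) (r-roots _) (r-roots _)

    Q-own-root≉0 : ∀ i → ¬ eval (Q i) (r i) ≈ 0#
    Q-own-root≉0 i Qi[ri]≈0 =
      1≉0 (trans (sym (Q-monic i)) (top-coeff-unique (Q i) (λ _ → 0#) r r-injective vanishes))
      where
      vanishes : ∀ j → eval (Q i) (r j) ≈ eval {n} (λ _ → 0#) (r j)
      vanishes j with i Fin.≟ j
      ... | yes ≡.refl = trans Qi[ri]≈0 (sym (eval-0# {n} (r j)))
      ... | no  i≢j    = trans (Q-root i≢j) (sym (eval-0# {n} (r j)))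

    P′ : Fin (suc n) → Carrier
    P′ i = eval (deriv P) (r i)

    P′≉0 : ∀ i → ¬ P′ i ≈ 0#
    P′≉0 i = Q-own-root≉0 i ∘ trans (sym (eval-deriv≈eval-quot P (r i)))

    w : Fin (suc n) → Carrier
    w i = P′ i ⁻¹

    w*Q≈1 : ∀ i → w i * eval (Q i) (r i) ≈ 1#
    w*Q≈1 i = begin
      w i * eval (Q i) (r i)   ≈⟨ *-congˡ (eval-deriv≈eval-quot P (r i)) ⟨
      w i * P′ i               ≈⟨ *-comm (w i) (P′ i) ⟩
      P′ i * w i               ≈⟨ ⁻¹-inverse (P′ i) (P′≉0 i) ⟩
      1#                       ∎

    -- Lagrange interpolation at the roots: p agrees there with Σᵢ p(rᵢ) Qᵢ / P′(rᵢ).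
    top-coeff-interpolation : (p : Poly n) → p (fromℕ n) ≈ sumFin (suc n) (λ i → eval p (r i) * w i)
    top-coeff-interpolation p = begin
      p (fromℕ n)
        ≈⟨ top-coeff-unique p L r r-injective p≈L ⟩
      sumFin (suc n) (λ i → α i * Q i (fromℕ n))
        ≈⟨ sumFin-cong (suc n) (λ i → trans (*-congˡ (Q-monic i)) (*-identityʳ (α i))) ⟩
      sumFin (suc n) α
        ∎
      where
      α : Fin (suc n) → Carrier
      α i = eval p (r i) * w i
      L : Poly n
      L l = sumFin (suc n) (λ i → α i * Q i l)
      p≈L : ∀ j → eval p (r j) ≈ eval L (r j)
      p≈L j = sym (begin
        eval L (r j)
          ≈⟨ eval-∑ (suc n) α Q (r j) ⟩
        sumFin (suc n) (λ i → α i * eval (Q i) (r j))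
          ≈⟨ sumFin-single (suc n) _ j (λ i i≢j → trans (*-congˡ (Q-root i≢j)) (zeroʳ (α i))) ⟩
        (eval p (r j) * w j) * eval (Q j) (r j)
          ≈⟨ *-assoc _ (w j) _ ⟩
        eval p (r j) * (w j * eval (Q j) (r j))
          ≈⟨ *-congˡ (w*Q≈1 j) ⟩
        eval p (r j) * 1#
          ≈⟨ *-identityʳ _ ⟩
        eval p (r j)
          ∎)

    powerSum-monomial : ∀ {m} → m < suc n → powerSum w r m ≈ monomial m (fromℕ n)
    powerSum-monomial {m} m<1+n = begin
      powerSum w r m
        ≈⟨ sumFin-cong (suc n) (λ i → *-congʳ {w i} (eval-monomial m<1+n (r i))) ⟨
      sumFin (suc n) (λ i → eval (monomial {n} m) (r i) * w i)
        ≈⟨ top-coeff-interpolation (monomial m) ⟨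
      monomial m (fromℕ n)
        ∎

    powerSum-below : ∀ m → m < n → powerSum w r m ≈ 0#
    powerSum-below m m<n = trans (powerSum-monomial (m<n⇒m<1+n m<n))
      (monomial-≢ (fromℕ n) (λ n≡m → <⇒≢ m<n (≡.trans (≡.sym n≡m) (toℕ-fromℕ n))))

    powerSum-top : powerSum w r n ≈ 1#
    powerSum-top = trans (powerSum-monomial (n<1+n n)) (monomial-≡ (fromℕ n) (toℕ-fromℕ n))

proposition1 : ∀ {c ℓ} (K : Field c ℓ) →
    let open Field K
        open FieldOps K
    in AlgClosed → CharZero →
       (n : ℕ) (G : HomPoly₂ (n ℕ.+ n)) (P : Poly (suc n)) → Monic P →
       (r : Fin (suc n) → Carrier) →
       (∀ i j → r i ≈ r j → i ≡ j) →
       (∀ i → eval P (r i) ≈ 0#) →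
       (∀ α → eval P α ≈ 0# → ∃ λ i → α ≈ r i) →
       sumFin (suc n) (λ i → sumFin (suc n) (λ j →
         evalHom G (r i) (r j) * ((eval (deriv P) (r i) * eval (deriv P) (r j)) ⁻¹)))
       ≈ G (middle n)
proposition1 K _ _ n G P P-monic r r-injective r-roots _ = begin
    sumFin (suc n) (λ i → sumFin (suc n) (λ j → evalHom G (r i) (r j) * ((P′ i * P′ j) ⁻¹)))
  ≈⟨ sumFin-cong (suc n) (λ i → sumFin-cong (suc n) (λ j →
       *-congˡ {evalHom G (r i) (r j)} (⁻¹-distrib-* (P′≉0 i) (P′≉0 j)))) ⟩
    sumFin (suc n) (λ i → sumFin (suc n) (λ j → evalHom G (r i) (r j) * (w i * w j)))
  ≈⟨ sumFin²-evalHom G r w ⟩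
    sumFin (suc (n ℕ.+ n)) (λ k → G k * (powerSum w r (toℕ k) * powerSum w r (n ℕ.+ n ℕ.∸ toℕ k)))
  ≈⟨ middle-term n G (powerSum w r) powerSum-below powerSum-top ⟩
    G (middle n)
  ∎
  where
  open Field K hiding (zero)
  open FieldOps K
  open FieldPolynomials K
  open SimpleRoots n P P-monic r (r-injective _ _) r-roots
  open import Relation.Binary.Reasoning.Setoid setoid
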